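{- Let $n=6k$ for a positive integer $k$, and let $G(n)$ be the graph on vertex set $\{v_1,\dots,v_n\}$ defined as follows: for $1\le i\le n/3$ the set $S_i=\{v_{3i-2},v_{3i-1},v_{3i}\}$ induces a triangle; for all $1\le j\le n-3$ the edge $v_jv_{j+3}$ is present; and for all $1\le i<n/3$ the edges $v_{3i-2}v_{3i+2}$, $v_{3i-1}v_{3i+3}$, $v_{3i}v_{3i+1}$ are present (and there are no other edges). Then $G(n)$ has no dominating set with at most $n/6$ vertices.
   Context: A dominating set of a graph is a set $D$ of vertices such that every vertex is in $D$ or adjacent to a vertex of $D$. -}

module Defs where

open import Data.Nat using (ℕ; zero; suc; _+_; _*_; _<_; _≤_)
open import Data.Fin using (Fin; toℕ)
open import Data.Fin.Subset using (Subset; _∈_)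
open import Data.Product using (Σ; _×_; ∃-syntax)
open import Data.Sum using (_⊎_)
open import Relation.Binary.PropositionalEquality using (_≡_)
open import Relation.Nullary using (¬_)

-- Vertices of G(n) are Fin n; vertex v_a of the paper (1 ≤ a ≤ n)
-- is the element of Fin n with toℕ equal to a - 1 (0-based indexing).

data Edge (n : ℕ) : ℕ → ℕ → Set where
  -- triangle on S_{m+1} = {3m, 3m+1, 3m+2} (0-based), for 3m+2 < n
  tri01 : ∀ m → 3 * m + 2 < n → Edge n (3 * m) (3 * m + 1)
  tri02 : ∀ m → 3 * m + 2 < n → Edge n (3 * m) (3 * m + 2)
  tri12 : ∀ m → 3 * m + 2 < n → Edge n (3 * m + 1) (3 * m + 2)
  -- v_j v_{j+3} for 1 ≤ j ≤ n-3, i.e. 0-based j' = j-1 with j' + 3 < n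
  step3 : ∀ j → j + 3 < n → Edge n j (j + 3)
  -- for 1 ≤ i < n/3, with m = i-1 (so 3m+3 < n, i.e. 3i < n):
  -- v_{3i-2} v_{3i+2}, v_{3i-1} v_{3i+3}, v_{3i} v_{3i+1}
  crossA : ∀ m → 3 * m + 3 < n → Edge n (3 * m) (3 * m + 4)
  crossB : ∀ m → 3 * m + 3 < n → Edge n (3 * m + 1) (3 * m + 5)
  crossC : ∀ m → 3 * m + 3 < n → Edge n (3 * m + 2) (3 * m + 3)

Adj : (n : ℕ) → Fin n → Fin n → Set
Adj n u v = Edge n (toℕ u) (toℕ v) ⊎ Edge n (toℕ v) (toℕ u)

IsDominating : (n : ℕ) → Subset n → Set
IsDominating n D = ∀ (v : Fin n) → v ∈ D ⊎ (∃[ u ] (u ∈ D × Adj n v u))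

module Submission where

-- Write the vertices of G(6k) as coordinates (M, t): position t ∈ {0,1,2} of the
-- triangle S_{M+1}, i.e. 0-based index 3M + t, for M < N = 2k.  Every edge either lies
-- inside a triangle or joins (M, s) to (M+1, t) with t = s or t = s + 1 (mod 3)
-- ('edge-near').  Let d M = |D ∩ S_{M+1}|.  If a triangle M is empty, each of its three
-- vertices is dominated from triangle M-1 or M+1, and a single vertex there dominates
-- only two of the three, so d (M-1) + d (M+1) ≥ 2 ('pigeonhole', 'empty-compensated').
--
-- The theorem then follows from a purely arithmetic charging argument on sequences
-- ('Charging'): if every zero entry of d below N has neighbours summing to at least 2 and
-- d N = 0, then the loads d(M-1) + 2 d M + d(M+1) are all at least 2, their total is at
-- most 4 Σ d minus d 0, and a look at the first one or two terms yields the strict bound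
-- N < 2 Σ d.  Since Σ d = |D| and N = 2k, the set D has more than k vertices.

open import Defs
open import Data.Nat using (ℕ; zero; suc; pred; _+_; _*_; _≤_; _<_; z≤n; s≤s; _≟_)
open import Data.Nat.Properties
open import Data.Nat.Tactic.RingSolver using (solve-∀)
open import Algebra.Properties.CommutativeSemigroup +-commutativeSemigroup using (interchange)
open import Data.Bool using (Bool; true; false; _∨_; T)
open import Data.Bool.Properties using (T-∨)
open import Data.Fin using (Fin; toℕ; fromℕ<)
open import Data.Fin.Properties using (toℕ-fromℕ<)
open import Data.Fin.Subset using (Subset; ∣_∣; _∈_)
open import Data.Vec using ([]; _∷_; here; there)
open import Data.Product using (_×_; _,_; ∃-syntax)
open import Data.Sum using (inj₁; inj₂)
open import Data.Empty using (⊥-elim)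
open import Function using (Equivalence; _∘_)
open import Relation.Nullary using (¬_; yes; no)
open import Relation.Binary.PropositionalEquality

Σ< : (ℕ → ℕ) → ℕ → ℕ
Σ< f zero    = 0
Σ< f (suc n) = Σ< f n + f n

Σ<-split : ∀ f m n → Σ< f (m + n) ≡ Σ< f m + Σ< (λ i → f (m + i)) n
Σ<-split f m zero    = trans (cong (Σ< f) (+-identityʳ m)) (sym (+-identityʳ _))
Σ<-split f m (suc n) = begin
  Σ< f (m + suc n)                                  ≡⟨ cong (Σ< f) (+-suc m n) ⟩
  Σ< f (m + n) + f (m + n)                          ≡⟨ cong (_+ f (m + n)) (Σ<-split f m n) ⟩
  (Σ< f m + Σ< (λ i → f (m + i)) n) + f (m + n)     ≡⟨ +-assoc (Σ< f m) _ _ ⟩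
  Σ< f m + Σ< (λ i → f (m + i)) (suc n)             ∎
  where open ≡-Reasoning

Σ<-shift : ∀ f n → Σ< f (suc n) ≡ f 0 + Σ< (λ i → f (suc i)) n
Σ<-shift f = Σ<-split f 1

Σ<-+ : ∀ f g n → Σ< (λ i → f i + g i) n ≡ Σ< f n + Σ< g n
Σ<-+ f g zero    = refl
Σ<-+ f g (suc n) =
  trans (cong (_+ (f n + g n)) (Σ<-+ f g n)) (sym (interchange (Σ< f n) (f n) (Σ< g n) (g n)))

Σ<-scale : ∀ c f n → Σ< (λ i → c * f i) n ≡ c * Σ< f n
Σ<-scale c f zero    = sym (*-zeroʳ c)
Σ<-scale c f (suc n) = trans (cong (_+ c * f n) (Σ<-scale c f n)) (sym (*-distribˡ-+ c (Σ< f n) (f n)))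

Σ<-lower : ∀ c f n → (∀ i → i < n → c ≤ f i) → n * c ≤ Σ< f n
Σ<-lower c f zero    bound = z≤n
Σ<-lower c f (suc n) bound = begin
  c + n * c         ≤⟨ +-mono-≤ (bound n ≤-refl) (Σ<-lower c f n (λ i i<n → bound i (m<n⇒m<1+n i<n))) ⟩
  f n + Σ< f n      ≡⟨ +-comm (f n) _ ⟩
  Σ< f (suc n)      ∎
  where open ≤-Reasoning

Σ<-blocks : ∀ b f N → Σ< f (b * N) ≡ Σ< (λ M → Σ< (λ i → f (b * M + i)) b) N
Σ<-blocks b f zero    = cong (Σ< f) (*-zeroʳ b)
Σ<-blocks b f (suc N) = begin
  Σ< f (b * suc N)                                   ≡⟨ cong (Σ< f) (trans (*-suc b N) (+-comm b _)) ⟩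
  Σ< f (b * N + b)                                   ≡⟨ Σ<-split f (b * N) b ⟩
  Σ< f (b * N) + Σ< (λ i → f (b * N + i)) b          ≡⟨ cong (_+ Σ< (λ i → f (b * N + i)) b) (Σ<-blocks b f N) ⟩
  Σ< (λ M → Σ< (λ i → f (b * M + i)) b) (suc N)      ∎
  where open ≡-Reasoning

before : (ℕ → ℕ) → ℕ → ℕ
before d zero    = 0
before d (suc M) = d M

-- Every zero entry of d below N is compensated: its two neighbours sum to at least 2.
-- For d M = |D ∩ S_{M+1}| this is what domination forces on an empty triangle.
Compensated : (ℕ → ℕ) → ℕ → Set
Compensated d N = ∀ M → M < N → d M ≡ 0 → 2 ≤ before d M + d (suc M)

-- Position M receives the load
-- d (M-1) + 2 d M + d (M+1); each entry of d is charged at most four times, and d 0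
-- only three times because there is no position -1.
module Charging (d : ℕ → ℕ) where

  load : ℕ → ℕ
  load M = 2 * d M + (before d M + d (suc M))

  -- Every position below N carries load at least 2: either d M ≥ 1 counts twice, or
  -- d M = 0 is compensated by its neighbours.
  load-≥2 : ∀ {N} → Compensated d N → ∀ M → M < N → 2 ≤ load M
  load-≥2 comp M M<N with d M in dM≡
  ... | zero  = comp M M<N dM≡
  ... | suc x = ≤-trans (*-monoʳ-≤ 2 (s≤s (z≤n {x}))) (m≤m+n _ _)

  load-upper : ∀ m → d (suc m) ≡ 0 → Σ< load (suc m) + d 0 ≤ (2 * Σ< d (suc m)) * 2
  load-upper m end = begin
    Σ< load N + d 0
      ≡⟨ cong (_+ d 0) (trans (Σ<-+ (λ M → 2 * d M) _ N)
                              (cong₂ _+_ (Σ<-scale 2 d N) (Σ<-+ (before d) (λ M → d (suc M)) N))) ⟩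
    (2 * S + (Σ< (before d) N + Σ< (λ M → d (suc M)) N)) + d 0
      ≡⟨ cong (λ x → (2 * S + (x + Σ< (λ M → d (suc M)) N)) + d 0) (Σ<-shift (before d) m) ⟩
    (2 * S + (Σ< d m + Σ< (λ M → d (suc M)) N)) + d 0
      ≡⟨ trans (+-assoc (2 * S) _ (d 0)) (cong (2 * S +_) (+-assoc (Σ< d m) _ (d 0))) ⟩
    2 * S + (Σ< d m + (Σ< (λ M → d (suc M)) N + d 0))
      ≤⟨ +-monoʳ-≤ (2 * S) (+-mono-≤ (m≤m+n (Σ< d m) (d m)) (≤-reflexive shifted)) ⟩
    2 * S + (S + S)
      ≡⟨ quadruple S ⟩
    (2 * S) * 2 ∎
    where
      open ≤-Reasoning
      quadruple : ∀ x → 2 * x + (x + x) ≡ (2 * x) * 2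
      quadruple = solve-∀
      N S : ℕ
      N = suc m
      S = Σ< d N
      shifted : Σ< (λ M → d (suc M)) N + d 0 ≡ S
      shifted = begin-equality
        Σ< (λ M → d (suc M)) N + d 0 ≡⟨ +-comm _ (d 0) ⟩
        d 0 + Σ< (λ M → d (suc M)) N ≡⟨ Σ<-shift d N ⟨
        S + d N                      ≡⟨ trans (cong (S +_) end) (+-identityʳ S) ⟩
        S ∎

  -- If d 0 ≥ 1, the missing charge d 0 itself provides the strict inequality.
  positive-start : ∀ m → Compensated d (suc m) → 0 < d 0 →
                   suc m * 2 < (load 0 + Σ< (λ M → load (suc M)) m) + d 0
  positive-start m comp 0<d0 =
    ≤-trans (m<m+n (2 + m * 2) 0<d0)
            (+-monoˡ-≤ (d 0) (+-mono-≤ (load-≥2 comp 0 (s≤s z≤n)) rest))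
    where
      rest : m * 2 ≤ Σ< (λ M → load (suc M)) m
      rest = Σ<-lower 2 _ m (λ M M<m → load-≥2 comp (suc M) (s≤s M<m))

  -- If d 0 = 0, compensation forces d 1 ≥ 2 (so N ≥ 2, as d N = 0), and then the second
  -- position carries load at least 4 instead of 2.
  empty-start : ∀ m → Compensated d (suc m) → d (suc m) ≡ 0 → d 0 ≡ 0 →
                suc m * 2 < (load 0 + Σ< (λ M → load (suc M)) m) + d 0
  empty-start zero comp end d0≡0 with subst (2 ≤_) end (comp 0 (s≤s z≤n) d0≡0)
  ... | ()
  empty-start (suc m) comp end d0≡0 = begin-strict
    suc (suc m) * 2
      <⟨ m<n+m _ {2} (s≤s z≤n) ⟩
    2 + (2 * 2 + m * 2)
      ≤⟨ +-mono-≤ (load-≥2 comp 0 (s≤s z≤n)) (+-mono-≤ four≤load₁ rest) ⟩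
    load 0 + (load 1 + Σ< (λ M → load (suc (suc M))) m)
      ≡⟨ cong (load 0 +_) (Σ<-shift (λ M → load (suc M)) m) ⟨
    load 0 + Σ< (λ M → load (suc M)) (suc m)
      ≡⟨ trans (cong (load 0 + Σ< (λ M → load (suc M)) (suc m) +_) d0≡0) (+-identityʳ _) ⟨
    (load 0 + Σ< (λ M → load (suc M)) (suc m)) + d 0
      ∎
    where
      open ≤-Reasoning
      four≤load₁ : 2 * 2 ≤ load 1
      four≤load₁ = ≤-trans (*-monoʳ-≤ 2 (comp 0 (s≤s z≤n) d0≡0)) (m≤m+n _ _)
      rest : m * 2 ≤ Σ< (λ M → load (suc (suc M))) m
      rest = Σ<-lower 2 _ m (λ M M<m → load-≥2 comp (suc (suc M)) (s≤s (s≤s M<m)))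

  load-lower : ∀ m → Compensated d (suc m) → d (suc m) ≡ 0 → suc m * 2 < Σ< load (suc m) + d 0
  load-lower m comp end = begin-strict
    suc m * 2                                  <⟨ first-terms ⟩
    (load 0 + Σ< (λ M → load (suc M)) m) + d 0 ≡⟨ cong (_+ d 0) (Σ<-shift load m) ⟨
    Σ< load (suc m) + d 0                      ∎
    where
      open ≤-Reasoning
      first-terms : suc m * 2 < (load 0 + Σ< (λ M → load (suc M)) m) + d 0
      first-terms with d 0 ≟ 0
      ... | no d0≢0 = positive-start m comp (n≢0⇒n>0 d0≢0)
      ... | yes d0≡0 = empty-start m comp end d0≡0

  more-than-half : ∀ m → Compensated d (suc m) → d (suc m) ≡ 0 → suc m < 2 * Σ< d (suc m)
  more-than-half m comp end =
    *-cancelʳ-< 2 (suc m) _ (<-≤-trans (load-lower m comp end) (load-upper m end))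

-- Subsets of Fin n read as 0/1 sequences indexed by ℕ (zero beyond n).
bit : Bool → ℕ
bit true  = 1
bit false = 0

member : ∀ {n} → Subset n → ℕ → Bool
member []      i       = false
member (x ∷ D) zero    = x
member (x ∷ D) (suc i) = member D i

member-∈ : ∀ {n} {D : Subset n} {u : Fin n} → u ∈ D → T (member D (toℕ u))
member-∈ here      = _
member-∈ (there p) = member-∈ p

member-beyond : ∀ {n} (D : Subset n) i → n ≤ i → member D i ≡ false
member-beyond []      i       _         = refl
member-beyond (x ∷ D) (suc i) (s≤s n≤i) = member-beyond D i n≤i

∣∣-as-sum : ∀ {n} (D : Subset n) → ∣ D ∣ ≡ Σ< (λ i → bit (member D i)) n
∣∣-as-sum []          = refl
∣∣-as-sum {suc n} (x ∷ D) =
  trans (head x) (trans (cong (bit x +_) (∣∣-as-sum D)) (sym (Σ<-shift _ n)))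
  where
    head : ∀ x → ∣ x ∷ D ∣ ≡ bit x + ∣ D ∣
    head true  = refl
    head false = refl

data Pos : Set where
  p₀ p₁ p₂ : Pos

pos : Pos → ℕ
pos p₀ = 0
pos p₁ = 1
pos p₂ = 2

rot : Pos → Pos
rot p₀ = p₁
rot p₁ = p₂
rot p₂ = p₀

rot⁻¹ : Pos → Pos
rot⁻¹ p₀ = p₂
rot⁻¹ p₁ = p₀
rot⁻¹ p₂ = p₁

pos<3 : ∀ t → pos t < 3
pos<3 p₀ = s≤s z≤n
pos<3 p₁ = s≤s (s≤s z≤n)
pos<3 p₂ = s≤s (s≤s (s≤s z≤n))

pos-injective : ∀ {s t} → pos s ≡ pos t → s ≡ t
pos-injective {p₀} {p₀} _ = refl
pos-injective {p₁} {p₁} _ = refl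
pos-injective {p₂} {p₂} _ = refl

coord : ℕ → Pos → ℕ
coord M t = 3 * M + pos t

coord-suc : ∀ M t → coord (suc M) t ≡ 3 + coord M t
coord-suc M t = shift M (pos t)
  where
    shift : ∀ M r → 3 * suc M + r ≡ 3 + (3 * M + r)
    shift = solve-∀

-- Coordinates are unique (uniqueness of division by 3 with remainder).
coord-injective : ∀ {M M' s t} → coord M s ≡ coord M' t → M ≡ M' × s ≡ t
coord-injective {zero}  {zero}          e = refl , pos-injective e
coord-injective {zero}  {suc M'} {s} {t} e =
  ⊥-elim (<⇒≱ (pos<3 s) (≤-trans (m≤m+n 3 _) (≤-reflexive (sym (trans e (coord-suc M' t))))))
coord-injective {suc M} {zero}   {s} {t} e =
  ⊥-elim (<⇒≱ (pos<3 t) (≤-trans (m≤m+n 3 _) (≤-reflexive (trans (sym (coord-suc M s)) e))))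
coord-injective {suc M} {suc M'} {s} {t} e with
  coord-injective {M} {M'} (+-cancelˡ-≡ 3 _ _ (trans (sym (coord-suc M s)) (trans e (coord-suc M' t))))
... | M≡M' , s≡t = cong suc M≡M' , s≡t

coord-split : ∀ j → ∃[ M ] ∃[ t ] coord M t ≡ j
coord-split 0 = 0 , p₀ , refl
coord-split 1 = 0 , p₁ , refl
coord-split 2 = 0 , p₂ , refl
coord-split (suc (suc (suc j))) with coord-split j
... | M , t , e = suc M , t , trans (coord-suc M t) (cong (3 +_) e)

coord-bound : ∀ {M N} t → M < N → coord M t < 3 * N
coord-bound {M} {N} t M<N = begin-strict
  3 * M + pos t  <⟨ +-monoʳ-< (3 * M) (pos<3 t) ⟩
  3 * M + 3      ≡⟨ trans (+-comm (3 * M) 3) (sym (*-suc 3 M)) ⟩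
  3 * suc M      ≤⟨ *-monoʳ-≤ 3 M<N ⟩
  3 * N          ∎
  where open ≤-Reasoning

-- Between consecutive triangles, position s of triangle M is joined to position t of
-- triangle M+1 exactly when t = s (edges v_j v_{j+3}) or t = s + 1 (the three cross edges).
data Link : Pos → Pos → Set where
  straight : ∀ {t} → Link t t
  twist    : ∀ {t} → Link t (rot t)

data Near : ℕ → ℕ → Set where
  inside : ∀ M s t → Near (coord M s) (coord M t)
  across : ∀ M {s t} → Link s t → Near (coord M s) (coord (suc M) t)

next-triangle : ∀ M r → 3 * M + (3 + r) ≡ 3 * suc M + r
next-triangle = solve-∀

edge-near : ∀ {n x y} → Edge n x y → Near x y
edge-near (tri01 m _) = subst (λ x → Near x (coord m p₁)) (+-identityʳ (3 * m)) (inside m p₀ p₁)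
edge-near (tri02 m _) = subst (λ x → Near x (coord m p₂)) (+-identityʳ (3 * m)) (inside m p₀ p₂)
edge-near (tri12 m _) = inside m p₁ p₂
edge-near (step3 j _) with coord-split j
... | M , t , refl = subst (Near _) (sym step) (across M straight)
  where
    step : coord M t + 3 ≡ coord (suc M) t
    step = trans (+-assoc (3 * M) (pos t) 3) (trans (cong (3 * M +_) (+-comm (pos t) 3)) (next-triangle M (pos t)))
edge-near (crossA m _) = subst₂ Near (+-identityʳ (3 * m)) (sym (next-triangle m 1)) (across m (twist {p₀}))
edge-near (crossB m _) = subst (Near _) (sym (next-triangle m 2)) (across m (twist {p₁}))
edge-near (crossC m _) = subst (Near _) (sym (next-triangle m 0)) (across m (twist {p₂}))

weight : (Pos → Bool) → ℕ
weight a = bit (a p₀) + bit (a p₁) + bit (a p₂)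

weight-zero : ∀ a → weight a ≡ 0 → ∀ t → ¬ T (a t)
weight-zero a w t at with ≤-trans (selected t (T⇒1≤bit at)) (≤-reflexive w)
  where
    T⇒1≤bit : ∀ {x} → T x → 1 ≤ bit x
    T⇒1≤bit {true} _ = s≤s z≤n
    selected : ∀ t → 1 ≤ bit (a t) → 1 ≤ weight a
    selected p₀ 1≤ = ≤-trans 1≤ (≤-trans (m≤m+n _ _) (m≤m+n _ _))
    selected p₁ 1≤ = ≤-trans 1≤ (≤-trans (m≤n+m _ (bit (a p₀))) (m≤m+n _ _))
    selected p₂ 1≤ = ≤-trans 1≤ (m≤n+m _ _)
... | ()

-- Position t of a triangle has a selected neighbour in the previous triangle (selection a)
-- or in the next one (selection b).
covered : (Pos → Bool) → (Pos → Bool) → Pos → Bool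
covered a b t = b t ∨ b (rot t) ∨ a t ∨ a (rot⁻¹ t)

rot⁻¹-rot : ∀ t → rot⁻¹ (rot t) ≡ t
rot⁻¹-rot p₀ = refl
rot⁻¹-rot p₁ = refl
rot⁻¹-rot p₂ = refl

∨-introˡ : ∀ x y → T x → T (x ∨ y)
∨-introˡ x y p = Equivalence.from (T-∨ {x} {y}) (inj₁ p)

∨-introʳ : ∀ x y → T y → T (x ∨ y)
∨-introʳ x y p = Equivalence.from (T-∨ {x} {y}) (inj₂ p)

cover-next : ∀ a b {t s} → Link t s → T (b s) → T (covered a b t)
cover-next a b {t} straight bs = ∨-introˡ (b t) _ bs
cover-next a b {t} twist    bs = ∨-introʳ (b t) _ (∨-introˡ (b (rot t)) _ bs)

cover-prev : ∀ a b {s t} → Link s t → T (a s) → T (covered a b t)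
cover-prev a b {s} straight as =
  ∨-introʳ (b s) _ (∨-introʳ (b (rot s)) _ (∨-introˡ (a s) _ as))
cover-prev a b {s} twist as =
  ∨-introʳ (b (rot s)) _ (∨-introʳ (b (rot (rot s))) _ (∨-introʳ (a (rot s)) _
    (subst (λ u → T (a u)) (sym (rot⁻¹-rot s)) as)))

-- Key local fact: a single vertex of an adjacent triangle is linked to only two of the
-- three positions, so covering all three needs at least two selected vertices.
-- The case analysis stops as soon as two selected vertices are visible.
pigeonhole : ∀ a b → (∀ t → T (covered a b t)) → 2 ≤ weight a + weight b
pigeonhole a b cov = count (a p₀) (a p₁) (a p₂) (b p₀) (b p₁) (b p₂) (cov p₀) (cov p₁) (cov p₂)
  where
    two : ∀ {x} → 2 ≤ suc (suc x)
    two = s≤s (s≤s z≤n)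
    count : ∀ a₀ a₁ a₂ b₀ b₁ b₂ →
            T (b₀ ∨ b₁ ∨ a₀ ∨ a₂) → T (b₁ ∨ b₂ ∨ a₁ ∨ a₀) → T (b₂ ∨ b₀ ∨ a₂ ∨ a₁) →
            2 ≤ (bit a₀ + bit a₁ + bit a₂) + (bit b₀ + bit b₁ + bit b₂)
    count true  true  _     _     _     _     _  _  _  = two
    count true  false true  _     _     _     _  _  _  = two
    count true  false false true  _     _     _  _  _  = two
    count true  false false false true  _     _  _  _  = two
    count true  false false false false true  _  _  _  = two
    count true  false false false false false _  _  ()
    count false true  true  _     _     _     _  _  _  = two
    count false true  false true  _     _     _  _  _  = two
    count false true  false false true  _     _  _  _  = two
    count false true  false false false true  _  _  _  = two
    count false true  false false false false () _  _
    count false false true  true  _     _     _  _  _  = two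
    count false false true  false true  _     _  _  _  = two
    count false false true  false false true  _  _  _  = two
    count false false true  false false false _  () _
    count false false false true  true  _     _  _  _  = two
    count false false false true  false true  _  _  _  = two
    count false false false true  false false _  () _
    count false false false false true  true  _  _  _  = two
    count false false false false true  false _  _  ()
    count false false false false false _     () _  _

module Triangles {n : ℕ} (D : Subset n) where

  inTriangle : ℕ → Pos → Bool
  inTriangle M t = member D (coord M t)

  inPrevious : ℕ → Pos → Bool
  inPrevious zero    t = false
  inPrevious (suc M) t = inTriangle M t

  size : ℕ → ℕ
  size M = weight (inTriangle M)

  size-before : ∀ M → before size M ≡ weight (inPrevious M)
  size-before zero    = refl
  size-before (suc M) = refl

  size-beyond : ∀ {M} → n ≤ 3 * M → size M ≡ 0
  size-beyond {M} n≤3M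
    rewrite member-beyond D (coord M p₀) (≤-trans n≤3M (m≤m+n _ _))
          | member-beyond D (coord M p₁) (≤-trans n≤3M (m≤m+n _ _))
          | member-beyond D (coord M p₂) (≤-trans n≤3M (m≤m+n _ _)) = refl

  ∣∣-by-triangles : ∀ {N} → n ≡ 3 * N → ∣ D ∣ ≡ Σ< size N
  ∣∣-by-triangles {N} n≡3N =
    trans (∣∣-as-sum D) (trans (cong (Σ< _) n≡3N) (Σ<-blocks 3 _ N))

  Empty : ℕ → Set
  Empty M = ∀ s → ¬ T (inTriangle M s)

  Covered : ℕ → Pos → Set
  Covered M t = T (covered (inPrevious M) (inTriangle (suc M)) t)

  -- A vertex of D adjacent to position t of an empty triangle M lies in triangle M ± 1
  -- and covers t; the two lemmas treat the two orientations of the edge.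
  covered-by-successor : ∀ {M t x y} → Empty M → Near x y → x ≡ coord M t → T (member D y) → Covered M t
  covered-by-successor {M} {t} empty (inside M' s s') x≡ y∈D with coord-injective {M'} {M} {s} {t} x≡
  ... | refl , refl = ⊥-elim (empty s' y∈D)
  covered-by-successor {M} {t} empty (across M' {s} link) x≡ y∈D with coord-injective {M'} {M} {s} {t} x≡
  ... | refl , refl = cover-next (inPrevious M) (inTriangle (suc M)) link y∈D

  covered-by-predecessor : ∀ {M t x y} → Empty M → Near y x → x ≡ coord M t → T (member D y) → Covered M t
  covered-by-predecessor {M} {t} empty (inside M' s' s) x≡ y∈D with coord-injective {M'} {M} {s} {t} x≡
  ... | refl , refl = ⊥-elim (empty s' y∈D)
  covered-by-predecessor {M} {t} empty (across M' {_} {s} link) x≡ y∈D with coord-injective {suc M'} {M} {s} {t} x≡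
  ... | refl , refl = cover-prev (inPrevious M) (inTriangle (suc M)) link y∈D

  dominated-from-outside : IsDominating n D → ∀ {M t} → Empty M → (v : Fin n) → toℕ v ≡ coord M t → Covered M t
  dominated-from-outside dom {M} {t} empty v v≡ with dom v
  ... | inj₁ v∈D               = ⊥-elim (empty t (subst (T ∘ member D) v≡ (member-∈ v∈D)))
  ... | inj₂ (u , u∈D , inj₁ e) = covered-by-successor {M} {t} empty (edge-near e) v≡ (member-∈ u∈D)
  ... | inj₂ (u , u∈D , inj₂ e) = covered-by-predecessor {M} {t} empty (edge-near e) v≡ (member-∈ u∈D)

  empty-compensated : IsDominating n D → ∀ M → (∀ t → coord M t < n) → size M ≡ 0 →
                      2 ≤ before size M + size (suc M)
  empty-compensated dom M bound empty =
    subst (λ w → 2 ≤ w + size (suc M)) (sym (size-before M))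
          (pigeonhole (inPrevious M) (inTriangle (suc M)) covered-everywhere)
    where
      covered-everywhere : ∀ t → Covered M t
      covered-everywhere t =
        dominated-from-outside dom {M} {t} (weight-zero _ empty) (fromℕ< (bound t)) (toℕ-fromℕ< (bound t))

proposition13 : (k : ℕ) → 1 ≤ k → (D : Subset (6 * k)) →
    IsDominating (6 * k) D → ¬ (∣ D ∣ ≤ k)
-- With N = 2k triangles, the triangle sizes of D form a compensated sequence that
-- vanishes at N, so 2 |D| > N = 2k, contradicting |D| ≤ k.
proposition13 (suc k) _ D dom small = <⇒≱ more-than-k (*-monoʳ-≤ 2 small)
  where
    open Triangles D
    N : ℕ
    N = 2 * suc k
    n≡3N : 6 * suc k ≡ 3 * N
    n≡3N = *-assoc 3 2 (suc k)
    compensated : Compensated size N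
    compensated M M<N =
      empty-compensated dom M (λ t → subst (coord M t <_) (sym n≡3N) (coord-bound t M<N))
    more-than-k : N < 2 * ∣ D ∣
    more-than-k = subst (λ s → N < 2 * s) (sym (∣∣-by-triangles {N} n≡3N))
                        (Charging.more-than-half size (pred N) compensated (size-beyond {N} (≤-reflexive n≡3N)))
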